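{- Let $u\geq 7$, $u\neq 8$, with $u\equiv 0,1,3,4,5,7,8,9,11\pmod{12}$. Then the graph $\langle \mathbb Z_u\cup\{\infty_1,\infty_2,\infty_3,\infty_4\},\{2,4\}\rangle$ can be decomposed into $3$-suns. (Here, for $u=7$, the difference $4$ is understood as $|4|_7=3$, i.e. the graph is $\langle \mathbb Z_7\cup\{\infty_1,\dots,\infty_4\},\{2,3\}\rangle$.)
   Context: A $3$-sun is the graph on six vertices $a,b,c,d,e,f$ with edges $\{a,b\},\{b,c\},\{c,a\},\{a,d\},\{b,e\},\{c,f\}$; a decomposition of a graph into $3$-suns is a partition of its edge set into subgraphs isomorphic to a $3$-sun. For a positive integer $u$, $\mathbb Z_u=\{0,1,\dots,u-1\}$ (integers mod $u$), and for distinct $i,j\in\mathbb Z_u$, $|i-j|_u=\min\{|i-j|,u-|i-j|\}$. For a set $H$ disjoint from $\mathbb Z_u$ and a nonempty set $D$ of positive integers, $\langle \mathbb Z_u\cup H,D\rangle$ is the graph with vertex set $\mathbb Z_u\cup H$ and edge set $\{\{i,j\}: i,j\in\mathbb Z_u,\ |i-j|_u\in \{|d|_u:d\in D\}\}\cup\{\{\infty,i\}:\infty\in H,\ i\in\mathbb Z_u\}$. -}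

module Defs where

open import Data.Nat using (ℕ; zero; suc; _⊓_; _∸_; ∣_-_∣; _%_)
open import Data.Fin using (Fin; toℕ; #_)
open import Data.Sum using (_⊎_; inj₁; inj₂)
open import Data.Product using (_×_; _,_; Σ; proj₁; proj₂)
open import Data.List using (List; length; lookup; _∷_; [])
open import Data.List.Relation.Unary.Any using (Any)
open import Data.Empty using (⊥)
open import Data.Unit using (⊤)
open import Relation.Binary.PropositionalEquality using (_≡_; _≢_)
open import Function.Definitions using (Injective)

-- |i - j|_u for i, j ∈ ℤ_u (represented by 0..u-1)
cdist : ℕ → ℕ → ℕ → ℕ
cdist u m n = ∣ m - n ∣ ⊓ (u ∸ ∣ m - n ∣)

absU : ℕ → ℕ → ℕ
absU zero    d = d
absU (suc n) d = cdist (suc n) (d % suc n) 0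

-- Vertex set ℤ_u ∪ H with H = {∞_1, …, ∞_h}
Vertex : ℕ → ℕ → Set
Vertex u h = Fin u ⊎ Fin h

Adj : (u h : ℕ) → List ℕ → Vertex u h → Vertex u h → Set
Adj u h D (inj₁ i) (inj₁ j) = (i ≢ j) × Any (λ d → cdist u (toℕ i) (toℕ j) ≡ absU u d) D
Adj u h D (inj₁ i) (inj₂ _) = ⊤
Adj u h D (inj₂ _) (inj₁ j) = ⊤
Adj u h D (inj₂ _) (inj₂ _) = ⊥

-- A 3-sun in a vertex set V: an injective labelling of a,b,c,d,e,f
-- (indices 0..5) by vertices of V.
record Sun (V : Set) : Set where
  field
    vert  : Fin 6 → V
    inj   : Injective _≡_ _≡_ vert

open Sun public

sunEdgeIx : Fin 6 → Fin 6 × Fin 6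
sunEdgeIx k = lookup table k
  where
  table : List (Fin 6 × Fin 6)
  table = (# 0 , # 1) ∷ (# 1 , # 2) ∷ (# 2 , # 0) ∷ (# 0 , # 3) ∷ (# 1 , # 4) ∷ (# 2 , # 5) ∷ []

sunEdge : {V : Set} → Sun V → Fin 6 → V × V
sunEdge s k = vert s (proj₁ (sunEdgeIx k)) , vert s (proj₂ (sunEdgeIx k))

SameEdge : {V : Set} → V × V → V × V → Set
SameEdge (x , y) (x' , y') = ((x ≡ x') × (y ≡ y')) ⊎ ((x ≡ y') × (y ≡ x'))

-- L is a decomposition of the graph with adjacency A into 3-suns:
-- every edge of every sun is an edge of the graph, every edge of the graph
-- is an edge of some sun, and no edge is covered by two distinct
-- (sun, edge-slot) pairs (so the edge sets of the suns partition E).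
record IsSunDecomposition {V : Set} (A : V → V → Set) (L : List (Sun V)) : Set where
  field
    sound    : ∀ (i : Fin (length L)) (k : Fin 6) →
               A (proj₁ (sunEdge (lookup L i) k)) (proj₂ (sunEdge (lookup L i) k))
    covers   : ∀ x y → A x y →
               Σ (Fin (length L)) λ i → Σ (Fin 6) λ k → SameEdge (sunEdge (lookup L i) k) (x , y)
    disjoint : ∀ (i i' : Fin (length L)) (k k' : Fin 6) →
               SameEdge (sunEdge (lookup L i) k) (sunEdge (lookup L i') k') →
               (i ≡ i') × (k ≡ k')

HasSunDecomposition : {V : Set} → (V → V → Set) → Set
HasSunDecomposition {V} A = Σ (List (Sun V)) λ L → IsSunDecomposition A L

module Submission where

-- Every position j of ℤ_u owns six edges: {j, j+2}, {j, j+4} and one edge to each ∞_k, namely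
-- {∞_k, j + e_k} with e = (0, 1, 2, 2); these sets of six partition the 6u edges of the graph.
-- Cut 0, …, u−1 into consecutive blocks of three and four positions, which is possible for every
-- u ≥ 7 except 8. For each block size there are as many 3-suns as positions, on points at most
-- seven ahead of the block start, whose edges are exactly the edges owned by the block; these are
-- two fixed finite configurations, checked by evaluation. Translating them onto every block gives
-- the decomposition: since u ≥ 7 the points of a translated sun stay distinct, and since u does
-- not divide 2, 4, 6 or 8 the owned edges of different positions never coincide.

open import Defs
open import Data.Nat using (ℕ; zero; suc; _+_; _*_; _∸_; _⊓_; ∣_-_∣; _≤_; _<_; _≮_; _≥_; _%_; _/_;
                            NonZero; >-nonZero; >-nonZero⁻¹; z≤n; s≤s; z<s; s≤s⁻¹; _<?_)
open import Data.Nat.Properties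
open import Data.Nat.DivMod
open import Data.Nat.Divisibility using (_∣_; divides; _∣?_; ∣⇒≤; m%n≡0⇒n∣m)
open import Data.Nat.ListAction using (sum)
open import Data.Fin using (Fin; zero; suc; toℕ; fromℕ<; #_) renaming (_≟_ to _≟ᶠ_)
open import Data.Fin.Properties using (all?; any?; toℕ-fromℕ<; toℕ<n; toℕ-injective)
open import Data.List using (List; []; _∷_; length; lookup; map; applyUpTo)
open import Data.List.Properties using (lookup-applyUpTo; length-applyUpTo)
open import Data.List.Membership.Propositional using (_∈_)
open import Data.List.Relation.Unary.Any using (here; there)
import Data.List.Relation.Unary.Any as Any
open import Data.Product using (_×_; _,_; proj₁; proj₂; ∃; ∃₂; uncurry)
import Data.Product as Prod
open import Data.Product.Properties using (×-≡,≡→≡) renaming (≡-dec to ×-≡-dec)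
open import Data.Sum using (_⊎_; inj₁; inj₂; [_,_]′)
import Data.Sum as Sum
open import Data.Sum.Properties using (inj₁-injective; inj₂-injective) renaming (≡-dec to ⊎-≡-dec)
open import Data.Unit using (⊤; tt)
open import Data.Vec using (Vec; _∷_; [])
import Data.Vec as Vec
open import Function using (_∘_)
open import Relation.Binary.Definitions using (DecidableEquality)
open import Relation.Binary.PropositionalEquality
open import Relation.Nullary using (Dec; yes; no; ¬?; _×-dec_; _⊎-dec_; _→-dec_; contradiction)
open import Relation.Nullary.Decidable using (True; toWitness; toWitnessFalse)

open ≡-Reasoning

-- Arithmetic modulo n

[m%n+k]%n≡[m+k]%n : ∀ m k n .{{_ : NonZero n}} → (m % n + k) % n ≡ (m + k) % n
[m%n+k]%n≡[m+k]%n m k n = begin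
  (m % n + k) % n            ≡⟨ %-distribˡ-+ (m % n) k n ⟩
  (m % n % n + k % n) % n    ≡⟨ cong (λ x → (x + k % n) % n) (m%n%n≡m%n m n) ⟩
  (m % n + k % n) % n        ≡⟨ %-distribˡ-+ m k n ⟨
  (m + k) % n                ∎

n∣m+[n∸m%n] : ∀ m n .{{_ : NonZero n}} → n ∣ m + (n ∸ m % n)
n∣m+[n∸m%n] m n = divides (suc (m / n)) (begin
  m + (n ∸ m % n)                    ≡⟨ cong (_+ (n ∸ m % n)) (m≡m%n+[m/n]*n m n) ⟩
  m % n + m / n * n + (n ∸ m % n)    ≡⟨ cong (_+ (n ∸ m % n)) (+-comm (m % n) (m / n * n)) ⟩
  m / n * n + m % n + (n ∸ m % n)    ≡⟨ +-assoc (m / n * n) (m % n) (n ∸ m % n) ⟩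
  m / n * n + (m % n + (n ∸ m % n))  ≡⟨ cong (m / n * n +_) (m+[n∸m]≡n (m%n≤n m n)) ⟩
  m / n * n + n                      ≡⟨ +-comm (m / n * n) n ⟩
  suc (m / n) * n                    ∎)

[m+k]%n≡[m+j]%n⇒k%n≡j%n : ∀ m k j n .{{_ : NonZero n}} → (m + k) % n ≡ (m + j) % n → k % n ≡ j % n
[m+k]%n≡[m+j]%n⇒k%n≡j%n m k j n eq = begin
  k % n                          ≡⟨ undo k ⟨
  ((m + k) % n + (n ∸ m % n)) % n  ≡⟨ cong (λ x → (x + (n ∸ m % n)) % n) eq ⟩
  ((m + j) % n + (n ∸ m % n)) % n  ≡⟨ undo j ⟩
  j % n                          ∎
  where
  undo : ∀ i → ((m + i) % n + (n ∸ m % n)) % n ≡ i % n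
  undo i = begin
    ((m + i) % n + (n ∸ m % n)) % n  ≡⟨ [m%n+k]%n≡[m+k]%n (m + i) (n ∸ m % n) n ⟩
    (m + i + (n ∸ m % n)) % n        ≡⟨ cong (λ x → (x + (n ∸ m % n)) % n) (+-comm m i) ⟩
    (i + m + (n ∸ m % n)) % n        ≡⟨ cong (_% n) (+-assoc i m (n ∸ m % n)) ⟩
    (i + (m + (n ∸ m % n))) % n      ≡⟨ %-remove-+ʳ i (n∣m+[n∸m%n] m n) ⟩
    i % n                            ∎

[m+k]%n≡m%n⇒k%n≡0 : ∀ m k n .{{_ : NonZero n}} → (m + k) % n ≡ m % n → k % n ≡ 0
[m+k]%n≡m%n⇒k%n≡0 m k n eq =
  trans ([m+k]%n≡[m+j]%n⇒k%n≡j%n m k 0 n (trans eq (cong (_% n) (sym (+-identityʳ m)))))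
        (m<n⇒m%n≡m (>-nonZero⁻¹ n))

∣m-k∣<n⇒m%n≡k%n⇒m≡k : ∀ m k n .{{_ : NonZero n}} → ∣ m - k ∣ < n → m % n ≡ k % n → m ≡ k
∣m-k∣<n⇒m%n≡k%n⇒m≡k m k n lt eq = [ (λ m≤k → sym (upper≡lower m≤k (subst (_< n) (m≤n⇒∣m-n∣≡n∸m m≤k) lt) (sym eq)))
                                    , (λ k≤m → upper≡lower k≤m (subst (_< n) (m≤n⇒∣n-m∣≡n∸m k≤m) lt) eq)
                                    ]′ (≤-total m k)
  where
  upper≡lower : ∀ {i j} → i ≤ j → j ∸ i < n → j % n ≡ i % n → j ≡ i
  upper≡lower {i} {j} i≤j d<n eq = begin
    j                ≡⟨ m+[n∸m]≡n i≤j ⟨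
    i + (j ∸ i)      ≡⟨ cong (i +_) (trans (sym (m<n⇒m%n≡m d<n)) d%n≡0) ⟩
    i + 0            ≡⟨ +-identityʳ i ⟩
    i                ∎
    where
    d%n≡0 : (j ∸ i) % n ≡ 0
    d%n≡0 = [m+k]%n≡m%n⇒k%n≡0 i (j ∸ i) n (trans (cong (_% n) (m+[n∸m]≡n i≤j)) eq)

absU≡d⊓[u∸d] : ∀ u d → d < u → absU u d ≡ d ⊓ (u ∸ d)
absU≡d⊓[u∸d] (suc w) d d<u rewrite m<n⇒m%n≡m d<u | ∣-∣-identityʳ d = refl

cdist-comm : ∀ u a b → cdist u a b ≡ cdist u b a
cdist-comm u a b = cong (λ x → x ⊓ (u ∸ x)) (∣-∣-comm a b)

[u∸x]⊓[u∸[u∸x]]≡x⊓[u∸x] : ∀ {u x} → x ≤ u → (u ∸ x) ⊓ (u ∸ (u ∸ x)) ≡ x ⊓ (u ∸ x)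
[u∸x]⊓[u∸[u∸x]]≡x⊓[u∸x] {u} {x} x≤u rewrite m∸[m∸n]≡n x≤u = ⊓-comm (u ∸ x) x

x⊓[u∸x]≡y⊓[u∸y]⇒x≡y⊎x≡u∸y : ∀ {u x y} → x ≤ u → y ≤ u →
                              x ⊓ (u ∸ x) ≡ y ⊓ (u ∸ y) → x ≡ y ⊎ x ≡ u ∸ y
x⊓[u∸x]≡y⊓[u∸y]⇒x≡y⊎x≡u∸y {u} {x} {y} x≤u y≤u eq with ≤-total x (u ∸ x) | ≤-total y (u ∸ y)
... | inj₁ p | inj₁ q = inj₁ (trans (sym (m≤n⇒m⊓n≡m p)) (trans eq (m≤n⇒m⊓n≡m q)))
... | inj₁ p | inj₂ q = inj₂ (trans (sym (m≤n⇒m⊓n≡m p)) (trans eq (m≥n⇒m⊓n≡n q)))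
... | inj₂ p | inj₁ q = inj₂ (trans (sym (m∸[m∸n]≡n x≤u))
                          (cong (u ∸_) (trans (sym (m≥n⇒m⊓n≡n p)) (trans eq (m≤n⇒m⊓n≡m q)))))
... | inj₂ p | inj₂ q = inj₁ (∸-cancelˡ-≡ x≤u y≤u (trans (sym (m≥n⇒m⊓n≡n p)) (trans eq (m≥n⇒m⊓n≡n q))))

cdist-m-[m+d]%n≡d⊓[n∸d] : ∀ n .{{_ : NonZero n}} {m d} → m < n → d < n → cdist n m ((m + d) % n) ≡ d ⊓ (n ∸ d)
cdist-m-[m+d]%n≡d⊓[n∸d] n {m} {d} m<n d<n with m + d <? n
... | yes m+d<n rewrite m<n⇒m%n≡m m+d<n | m≤n⇒∣m-n∣≡n∸m (m≤m+n m d) | m+n∸m≡n m d = refl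
... | no m+d≮n = begin
  cdist n m ((m + d) % n)  ≡⟨ cong (cdist n m) wrapped ⟩
  cdist n m (m ∸ k)        ≡⟨ cong (λ x → x ⊓ (n ∸ x)) (trans (m≤n⇒∣n-m∣≡n∸m (m∸n≤m m k)) (m∸[m∸n]≡n k≤m)) ⟩
  k ⊓ (n ∸ k)              ≡⟨ [u∸x]⊓[u∸[u∸x]]≡x⊓[u∸x] (<⇒≤ d<n) ⟩
  d ⊓ (n ∸ d)              ∎
  where
  k = n ∸ d
  k≤m : k ≤ m
  k≤m = m≤n+o⇒m∸n≤o n d (subst (n ≤_) (+-comm m d) (≮⇒≥ m+d≮n))
  m+d≡[m∸k]+n : m + d ≡ m ∸ k + n
  m+d≡[m∸k]+n = begin
    m + d              ≡⟨ cong (_+ d) (m∸n+n≡m k≤m) ⟨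
    m ∸ k + k + d      ≡⟨ +-assoc (m ∸ k) k d ⟩
    m ∸ k + (k + d)    ≡⟨ cong (m ∸ k +_) (m∸n+n≡m (<⇒≤ d<n)) ⟩
    m ∸ k + n          ∎
  wrapped : (m + d) % n ≡ m ∸ k
  wrapped = begin
    (m + d) % n        ≡⟨ cong (_% n) m+d≡[m∸k]+n ⟩
    (m ∸ k + n) % n    ≡⟨ [m+n]%n≡m%n (m ∸ k) n ⟩
    (m ∸ k) % n        ≡⟨ m<n⇒m%n≡m (≤-<-trans (m∸n≤m m k) m<n) ⟩
    m ∸ k              ∎

cdist≡d⊓[n∸d]⇒b≡[a+d]%n⊎a≡[b+d]%n : ∀ n .{{_ : NonZero n}} {a b d} → a < n → b < n → d ≤ n →
                 cdist n a b ≡ d ⊓ (n ∸ d) → b ≡ (a + d) % n ⊎ a ≡ (b + d) % n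
cdist≡d⊓[n∸d]⇒b≡[a+d]%n⊎a≡[b+d]%n n {a} {b} {d} a<n b<n d≤n eq =
  [ (λ a≤b → oriented a≤b b<n eq)
  , (λ b≤a → Sum.swap (oriented b≤a a<n (trans (cdist-comm n b a) eq)))
  ]′ (≤-total a b)
  where
  oriented : ∀ {a b} → a ≤ b → b < n → cdist n a b ≡ d ⊓ (n ∸ d) → b ≡ (a + d) % n ⊎ a ≡ (b + d) % n
  oriented {a} {b} a≤b b<n eq
    with x⊓[u∸x]≡y⊓[u∸y]⇒x≡y⊎x≡u∸y (≤-trans (m∸n≤m b a) (<⇒≤ b<n)) d≤n
           (subst (λ x → x ⊓ (n ∸ x) ≡ d ⊓ (n ∸ d)) (m≤n⇒∣m-n∣≡n∸m a≤b) eq)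
  ... | inj₁ b∸a≡d = inj₁ (begin
    b            ≡⟨ m<n⇒m%n≡m b<n ⟨
    b % n        ≡⟨ cong (_% n) (trans (sym (m+[n∸m]≡n a≤b)) (cong (a +_) b∸a≡d)) ⟩
    (a + d) % n  ∎)
  ... | inj₂ b∸a≡n∸d = inj₂ (begin
    a            ≡⟨ m<n⇒m%n≡m (≤-<-trans a≤b b<n) ⟨
    a % n        ≡⟨ [m+n]%n≡m%n a n ⟨
    (a + n) % n  ≡⟨ cong (_% n) b+d≡a+n ⟨
    (b + d) % n  ∎)
    where
    b+d≡a+n : b + d ≡ a + n
    b+d≡a+n = begin
      b + d              ≡⟨ cong (_+ d) (m+[n∸m]≡n a≤b) ⟨
      a + (b ∸ a) + d    ≡⟨ +-assoc a (b ∸ a) d ⟩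
      a + (b ∸ a + d)    ≡⟨ cong (λ x → a + (x + d)) b∸a≡n∸d ⟩
      a + (n ∸ d + d)    ≡⟨ cong (a +_) (m∸n+n≡m d≤n) ⟩
      a + n              ∎

SameEdge-sym : {A : Set} {e e′ : A × A} → SameEdge e e′ → SameEdge e′ e
SameEdge-sym (inj₁ (p , q)) = inj₁ (sym p , sym q)
SameEdge-sym (inj₂ (p , q)) = inj₂ (sym q , sym p)

SameEdge-trans : {A : Set} {e e′ e″ : A × A} → SameEdge e e′ → SameEdge e′ e″ → SameEdge e e″
SameEdge-trans (inj₁ (p , q)) (inj₁ (r , s)) = inj₁ (trans p r , trans q s)
SameEdge-trans (inj₁ (p , q)) (inj₂ (r , s)) = inj₂ (trans p r , trans q s)
SameEdge-trans (inj₂ (p , q)) (inj₁ (r , s)) = inj₂ (trans p s , trans q r)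
SameEdge-trans (inj₂ (p , q)) (inj₂ (r , s)) = inj₁ (trans p s , trans q r)

SameEdge-map : {A B : Set} (f : A → B) {e e′ : A × A} → SameEdge e e′ → SameEdge (Prod.map f f e) (Prod.map f f e′)
SameEdge-map f (inj₁ (p , q)) = inj₁ (cong f p , cong f q)
SameEdge-map f (inj₂ (p , q)) = inj₂ (cong f p , cong f q)

sameEdge? : {A : Set} → DecidableEquality A → ∀ (e e′ : A × A) → Dec (SameEdge e e′)
sameEdge? _≟_ (x , y) (x′ , y′) = (x ≟ x′ ×-dec y ≟ y′) ⊎-dec (x ≟ y′ ×-dec y ≟ x′)

sunEdgeOf : {A : Set} → (Fin 6 → A) → Fin 6 → A × A
sunEdgeOf v k = v (proj₁ (sunEdgeIx k)) , v (proj₂ (sunEdgeIx k))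

-- Base edges and base blocks

-- `pt o` is the point o positions after the start of the block carrying the sun.
Point : Set
Point = ℕ ⊎ Fin 4

pattern pt o = inj₁ o
pattern ∞ k  = inj₂ k

_≟ₚ_ : DecidableEquality Point
_≟ₚ_ = ⊎-≡-dec _≟_ _≟ᶠ_

∞₁ ∞₂ ∞₃ ∞₄ : Point
∞₁ = ∞ (# 0)
∞₂ = ∞ (# 1)
∞₃ = ∞ (# 2)
∞₄ = ∞ (# 3)

shift : ℕ → Point → Point
shift s = Sum.map₁ (s +_)

∞-offset : Fin 4 → ℕ
∞-offset zero          = 0
∞-offset (suc zero)    = 1
∞-offset (suc (suc _)) = 2

∞-offset≤2 : ∀ k → ∞-offset k ≤ 2
∞-offset≤2 zero          = z≤n
∞-offset≤2 (suc zero)    = s≤s z≤n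
∞-offset≤2 (suc (suc _)) = ≤-refl

baseEdge : ℕ → Fin 6 → Point × Point
baseEdge j zero          = pt j , pt (j + 2)
baseEdge j (suc zero)    = pt j , pt (j + 4)
baseEdge j (suc (suc k)) = ∞ k , pt (j + ∞-offset k)

shift-baseEdge : ∀ s j c → Prod.map (shift s) (shift s) (baseEdge j c) ≡ baseEdge (s + j) c
shift-baseEdge s j zero          = cong (λ x → pt (s + j) , pt x) (sym (+-assoc s j 2))
shift-baseEdge s j (suc zero)    = cong (λ x → pt (s + j) , pt x) (sym (+-assoc s j 4))
shift-baseEdge s j (suc (suc k)) = cong (λ x → ∞ k , pt x) (sym (+-assoc s j (∞-offset k)))

-- Inverts baseEdge up to orientation; junk on pairs that are not base edges.
baseSlot : Point × Point → ℕ × Fin 6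
baseSlot (pt a , pt b) = a ⊓ b , diffKind ∣ a - b ∣
  where
  diffKind : ℕ → Fin 6
  diffKind 2 = zero
  diffKind _ = suc zero
baseSlot (∞ k , pt b) = b ∸ ∞-offset k , suc (suc k)
baseSlot (pt b , ∞ k) = b ∸ ∞-offset k , suc (suc k)
baseSlot (∞ _ , ∞ _)  = 0 , zero

-- Points that stay distinct after translation into ℤ_u for every u ≥ 7.
Separated : Point → Point → Set
Separated (pt a) (pt b) = a ≢ b × ∣ a - b ∣ < 7
Separated (∞ i)  (∞ j)  = i ≢ j
Separated _      _      = ⊤

separated? : ∀ p q → Dec (Separated p q)
separated? (pt a) (pt b) = ¬? (a ≟ b) ×-dec ∣ a - b ∣ <? 7
separated? (∞ i)  (∞ j)  = ¬? (i ≟ᶠ j)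
separated? (pt _) (∞ _)  = yes tt
separated? (∞ _)  (pt _) = yes tt

data Block : Set where
  B₃ B₄ : Block

size : Block → ℕ
size B₃ = 3
size B₄ = 4

sun : Block → ℕ → Vec Point 6
sun B₃ 0 = pt 1 ∷ ∞₂   ∷ pt 3 ∷ pt 5 ∷ pt 2 ∷ ∞₃   ∷ []
sun B₃ 1 = ∞₁   ∷ pt 2 ∷ pt 0 ∷ pt 1 ∷ ∞₃   ∷ pt 4 ∷ []
sun B₃ 2 = pt 2 ∷ pt 4 ∷ ∞₄   ∷ pt 6 ∷ ∞₃   ∷ pt 3 ∷ []
sun B₄ 0 = pt 3 ∷ ∞₃   ∷ pt 5 ∷ pt 7 ∷ pt 2 ∷ pt 1 ∷ []
sun B₄ 1 = ∞₂   ∷ pt 3 ∷ pt 1 ∷ pt 4 ∷ ∞₄   ∷ ∞₁   ∷ []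
sun B₄ 2 = pt 2 ∷ pt 0 ∷ ∞₁   ∷ pt 6 ∷ pt 4 ∷ pt 3 ∷ []
sun B₄ 3 = pt 2 ∷ pt 4 ∷ ∞₄   ∷ ∞₂   ∷ ∞₃   ∷ pt 5 ∷ []
sun _  _ = Vec.replicate 6 ∞₁

point : Block → ℕ → Fin 6 → Point
point b t = Vec.lookup (sun b t)

slot : Block → ℕ → Fin 6 → ℕ × Fin 6
slot b t k = baseSlot (sunEdgeOf (point b t) k)

_≟ₛ_ : DecidableEquality (ℕ × Fin 6)
_≟ₛ_ = ×-≡-dec _≟_ _≟ᶠ_

∀Fin⇒∀< : ∀ {n} {P : ℕ → Set} → (∀ (i : Fin n) → P (toℕ i)) → ∀ {m} → m < n → P m
∀Fin⇒∀< {P = P} f m<n = subst P (toℕ-fromℕ< m<n) (f (fromℕ< m<n))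

allSuns? : {P : Block → ℕ → Set} → (∀ b t → Dec (P b t)) → ∀ b → Dec (∀ (t : Fin (size b)) → P b (toℕ t))
allSuns? P? b = all? (P? b ∘ toℕ)

-- The two implicit arguments are discharged by evaluating the decision procedure.
inEveryBlock : {P : Block → ℕ → Set} (P? : ∀ b t → Dec (P b t)) →
               {True (allSuns? P? B₃)} → {True (allSuns? P? B₄)} →
               ∀ b {t} → t < size b → P b t
inEveryBlock P? {p₃} B₃ = ∀Fin⇒∀< (toWitness {a? = allSuns? P? B₃} p₃)
inEveryBlock P? {_} {p₄} B₄ = ∀Fin⇒∀< (toWitness {a? = allSuns? P? B₄} p₄)

EdgesAreBase : Block → ℕ → Set
EdgesAreBase b t = ∀ k → SameEdge (sunEdgeOf (point b t) k) (uncurry baseEdge (slot b t k))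

SlotsInBlock : Block → ℕ → Set
SlotsInBlock b t = ∀ k → proj₁ (slot b t k) < size b

SunSeparated : Block → ℕ → Set
SunSeparated b t = ∀ k k′ → k ≢ k′ → Separated (point b t k) (point b t k′)

SlotsCovered : Block → ℕ → Set
SlotsCovered b x = ∀ c → ∃₂ λ (t : Fin (size b)) k → slot b (toℕ t) k ≡ (x , c)

SlotsDistinct : Block → ℕ → Set
SlotsDistinct b t = ∀ (t′ : Fin (size b)) k k′ → slot b t k ≡ slot b (toℕ t′) k′ → t ≡ toℕ t′ × k ≡ k′

sunEdge-base : ∀ b {t} → t < size b → EdgesAreBase b t
sunEdge-base = inEveryBlock λ b t → all? λ k →
  sameEdge? _≟ₚ_ (sunEdgeOf (point b t) k) (uncurry baseEdge (slot b t k))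

slot-< : ∀ b {t} → t < size b → SlotsInBlock b t
slot-< = inEveryBlock λ b t → all? λ k → proj₁ (slot b t k) <? size b

sun-separated : ∀ b {t} → t < size b → SunSeparated b t
sun-separated = inEveryBlock λ b t → all? λ k → all? λ k′ →
  ¬? (k ≟ᶠ k′) →-dec separated? (point b t k) (point b t k′)

slotsCovered? : ∀ b x → Dec (SlotsCovered b x)
slotsCovered? b x = all? λ c → any? λ t → any? λ k → slot b (toℕ t) k ≟ₛ (x , c)

slot-surjective : ∀ b {x} → x < size b → ∀ c → ∃₂ λ t k → t < size b × slot b t k ≡ (x , c)
slot-surjective b x<b c with inEveryBlock slotsCovered? b x<b c
... | t , k , eq = toℕ t , k , toℕ<n t , eq

slotsDistinct? : ∀ b t → Dec (SlotsDistinct b t)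
slotsDistinct? b t = all? λ t′ → all? λ k → all? λ k′ →
  slot b t k ≟ₛ slot b (toℕ t′) k′ →-dec (t ≟ toℕ t′ ×-dec k ≟ᶠ k′)

slot-injective : ∀ b {t t′} → t < size b → t′ < size b → ∀ k k′ → slot b t k ≡ slot b t′ k′ → t ≡ t′ × k ≡ k′
slot-injective b {t} t<b = ∀Fin⇒∀< {P = λ t′ → ∀ k k′ → slot b t k ≡ slot b t′ k′ → t ≡ t′ × k ≡ k′}
  (inEveryBlock slotsDistinct? b t<b)

-- Tilings by blocks

record Place : Set where
  constructor place
  field
    block  : Block
    start  : ℕ
    offset : ℕ

open Place public

shiftPlace : ℕ → Place → Place
shiftPlace m p = record p { start = m + start p }

total : List Block → ℕ
total bs = sum (map size bs)

-- Positions past the last block get the junk place (B₃, n, 0), so offsets always lie inside their block.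
locate : List Block → ℕ → Place
locate []       n = place B₃ n 0
locate (b ∷ bs) n with n <? size b
... | yes _ = place b 0 n
... | no  _ = shiftPlace (size b) (locate bs (n ∸ size b))

locate-start+offset : ∀ bs n → start (locate bs n) + offset (locate bs n) ≡ n
locate-start+offset []       n = +-identityʳ n
locate-start+offset (b ∷ bs) n with n <? size b
... | yes _ = refl
... | no n≮b = begin
  size b + start p + offset p    ≡⟨ +-assoc (size b) (start p) (offset p) ⟩
  size b + (start p + offset p)  ≡⟨ cong (size b +_) (locate-start+offset bs (n ∸ size b)) ⟩
  size b + (n ∸ size b)          ≡⟨ m+[n∸m]≡n (≮⇒≥ n≮b) ⟩
  n                              ∎
  where
  p : Place
  p = locate bs (n ∸ size b)

n∸size<total : ∀ b bs {n} → n ≮ size b → n < size b + total bs → n ∸ size b < total bs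
n∸size<total b bs {n} n≮b n<total =
  +-cancelˡ-< (size b) _ _ (subst (_< size b + total bs) (sym (m+[n∸m]≡n (≮⇒≥ n≮b))) n<total)

locate-offset< : ∀ bs n → offset (locate bs n) < size (block (locate bs n))
locate-offset< []       n = s≤s z≤n
locate-offset< (b ∷ bs) n with n <? size b
... | yes n<b = n<b
... | no _    = locate-offset< bs (n ∸ size b)

locate-end≤total : ∀ bs {n} → n < total bs → start (locate bs n) + size (block (locate bs n)) ≤ total bs
locate-end≤total (b ∷ bs) {n} n<total with n <? size b
... | yes _ = m≤m+n (size b) (total bs)
... | no n≮b = subst (_≤ size b + total bs) (sym (+-assoc (size b) (start p) (size (block p))))
                (+-monoʳ-≤ (size b) (locate-end≤total bs (n∸size<total b bs n≮b n<total)))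
  where
  p : Place
  p = locate bs (n ∸ size b)

locate-head : ∀ b bs {x} → x < size b → locate (b ∷ bs) x ≡ place b 0 x
locate-head b bs {x} x<b with x <? size b
... | yes _   = refl
... | no x≮b  = contradiction x<b x≮b

locate-skip : ∀ b bs m → locate (b ∷ bs) (size b + m) ≡ shiftPlace (size b) (locate bs m)
locate-skip b bs m with size b + m <? size b
... | yes b+m<b = contradiction b+m<b (m+n≮m (size b) m)
... | no _ = cong (shiftPlace (size b) ∘ locate bs) (m+n∸m≡n (size b) m)

locate-sameBlock : ∀ bs {n x} → n < total bs → x < size (block (locate bs n)) →
                   locate bs (start (locate bs n) + x) ≡ place (block (locate bs n)) (start (locate bs n)) x
locate-sameBlock (b ∷ bs) {n} {x} n<total x<size with n <? size b
... | yes _ = locate-head b bs x<size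
... | no n≮b = begin
  locate (b ∷ bs) (size b + start p + x)    ≡⟨ cong (locate (b ∷ bs)) (+-assoc (size b) (start p) x) ⟩
  locate (b ∷ bs) (size b + (start p + x))  ≡⟨ locate-skip b bs (start p + x) ⟩
  shiftPlace (size b) (locate bs (start p + x))
    ≡⟨ cong (shiftPlace (size b)) (locate-sameBlock bs (n∸size<total b bs n≮b n<total) x<size) ⟩
  place (block p) (size b + start p) x      ∎
  where
  p : Place
  p = locate bs (n ∸ size b)

slotAt : Place → Fin 6 → ℕ × Fin 6
slotAt p k = Prod.map₁ (start p +_) (slot (block p) (offset p) k)

slotAt-injective : ∀ {p p′} k k′ → block p ≡ block p′ → start p ≡ start p′ →
                   offset p < size (block p) → offset p′ < size (block p′) →
                   slotAt p k ≡ slotAt p′ k′ → offset p ≡ offset p′ × k ≡ k′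
slotAt-injective {place b s t} {place .b .s t′} k k′ refl refl t<b t′<b eq =
  slot-injective b t<b t′<b k k′
    (×-≡,≡→≡ (+-cancelˡ-≡ s _ _ (cong proj₁ eq) , cong proj₂ eq))

3s-and-4s-from-9 : ∀ m → ∃ λ bs → total bs ≡ 9 + m
3s-and-4s-from-9 0 = B₃ ∷ B₃ ∷ B₃ ∷ [] , refl
3s-and-4s-from-9 1 = B₄ ∷ B₃ ∷ B₃ ∷ [] , refl
3s-and-4s-from-9 2 = B₄ ∷ B₄ ∷ B₃ ∷ [] , refl
3s-and-4s-from-9 (suc (suc (suc m))) = let bs , total≡ = 3s-and-4s-from-9 m in B₃ ∷ bs , cong (3 +_) total≡

tiling : ∀ u → u ≥ 7 → u ≢ 8 → ∃ λ bs → total bs ≡ u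
tiling u u≥7 u≢8 = subst (λ v → v ≢ 8 → ∃ λ bs → total bs ≡ v) (m+[n∸m]≡n u≥7) (from7 (u ∸ 7)) u≢8
  where
  from7 : ∀ m → 7 + m ≢ 8 → ∃ λ bs → total bs ≡ 7 + m
  from7 0             _   = B₄ ∷ B₃ ∷ [] , refl
  from7 1             7≢8 = contradiction refl 7≢8
  from7 (suc (suc m)) _   = 3s-and-4s-from-9 m

-- The decomposition

module Construction (u : ℕ) .{{_ : NonZero u}} (7≤u : 7 ≤ u) (u≢8 : u ≢ 8) where

  V : Set
  V = Vertex u 4

  G : V → V → Set
  G = Adj u 4 (2 ∷ 4 ∷ [])

  vertex : Point → V
  vertex = Sum.map₁ (_mod u)

  edge : ℕ → Fin 6 → V × V
  edge j c = Prod.map vertex vertex (baseEdge j c)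

  diffEdge : ℕ → ℕ → V × V
  diffEdge j d = inj₁ (j mod u) , inj₁ ((j + d) mod u)

  toℕ-mod : ∀ m → toℕ (m mod u) ≡ m % u
  toℕ-mod m = toℕ-fromℕ< (m%n<n m u)

  mod-≡⇒%-≡ : ∀ {m k} → m mod u ≡ k mod u → m % u ≡ k % u
  mod-≡⇒%-≡ {m} {k} eq = trans (sym (toℕ-mod m)) (trans (cong toℕ eq) (toℕ-mod k))

  %-injective : ∀ {m k} → m < u → k < u → m % u ≡ k % u → m ≡ k
  %-injective m<u k<u eq = trans (sym (m<n⇒m%n≡m m<u)) (trans eq (m<n⇒m%n≡m k<u))

  toℕ≡%⇒mod≡ : ∀ {m} {i : Fin u} → toℕ i ≡ m % u → m mod u ≡ i
  toℕ≡%⇒mod≡ {m} eq = toℕ-injective (trans (toℕ-mod m) (sym eq))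

  toℕ-mod-inverse : (i : Fin u) → toℕ i mod u ≡ i
  toℕ-mod-inverse i = toℕ≡%⇒mod≡ (sym (m<n⇒m%n≡m (toℕ<n i)))

  2<u : 2 < u
  2<u = ≤-trans (m≤m+n 3 4) 7≤u

  4<u : 4 < u
  4<u = ≤-trans (m≤m+n 5 2) 7≤u

  6<u : 6 < u
  6<u = 7≤u

  ∞-offset≤u : ∀ k → ∞-offset k ≤ u
  ∞-offset≤u k = ≤-trans (∞-offset≤2 k) (<⇒≤ 2<u)

  0<d<u⇒d%u≢0 : ∀ {d} → 0 < d → d < u → d % u ≢ 0
  0<d<u⇒d%u≢0 {d} 0<d d<u eq = <⇒≢ 0<d (trans (sym eq) (m<n⇒m%n≡m d<u))

  8%u≢0 : 8 % u ≢ 0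
  8%u≢0 eq = toWitnessFalse {a? = 7 ∣? 8} tt (subst (_∣ 8) u≡7 u∣8)
    where
    u∣8 : u ∣ 8
    u∣8 = m%n≡0⇒n∣m 8 u eq
    u≡7 : u ≡ 7
    u≡7 = ≤-antisym (s≤s⁻¹ (≤∧≢⇒< (∣⇒≤ u∣8) u≢8)) 7≤u

  diffEdge-adjacent : ∀ j {d} → 0 < d → d < u →
                  (j mod u ≢ (j + d) mod u) × cdist u (toℕ (j mod u)) (toℕ ((j + d) mod u)) ≡ absU u d
  diffEdge-adjacent j {d} 0<d d<u = distinct , distance
    where
    distinct : j mod u ≢ (j + d) mod u
    distinct eq = 0<d<u⇒d%u≢0 0<d d<u ([m+k]%n≡m%n⇒k%n≡0 j d u (sym (mod-≡⇒%-≡ eq)))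
    distance : cdist u (toℕ (j mod u)) (toℕ ((j + d) mod u)) ≡ absU u d
    distance = begin
      cdist u (toℕ (j mod u)) (toℕ ((j + d) mod u))  ≡⟨ cong₂ (cdist u) (toℕ-mod j) (toℕ-mod (j + d)) ⟩
      cdist u (j % u) ((j + d) % u)                  ≡⟨ cong (cdist u (j % u)) ([m%n+k]%n≡[m+k]%n j d u) ⟨
      cdist u (j % u) ((j % u + d) % u)              ≡⟨ cdist-m-[m+d]%n≡d⊓[n∸d] u (m%n<n j u) d<u ⟩
      d ⊓ (u ∸ d)                                    ≡⟨ absU≡d⊓[u∸d] u d d<u ⟨
      absU u d                                       ∎

  edge-adjacent : ∀ j c → G (proj₁ (edge j c)) (proj₂ (edge j c))
  edge-adjacent j zero          = Prod.map₂ here (diffEdge-adjacent j z<s 2<u)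
  edge-adjacent j (suc zero)    = Prod.map₂ (there ∘ here) (diffEdge-adjacent j z<s 4<u)
  edge-adjacent j (suc (suc k)) = tt

  G-sym : ∀ x y → G x y → G y x
  G-sym (inj₁ i) (inj₁ j) (i≢j , d) = i≢j ∘ sym , Any.map (trans (cdist-comm u (toℕ j) (toℕ i))) d
  G-sym (inj₁ _) (inj₂ _) _ = tt
  G-sym (inj₂ _) (inj₁ _) _ = tt

  G-resp-SameEdge : ∀ {e e′} → G (proj₁ e) (proj₂ e) → SameEdge e e′ → G (proj₁ e′) (proj₂ e′)
  G-resp-SameEdge g (inj₁ (refl , refl)) = g
  G-resp-SameEdge {x , y} g (inj₂ (refl , refl)) = G-sym x y g

  diffEdge-cover : ∀ (a b : Fin u) {d} → d < u → cdist u (toℕ a) (toℕ b) ≡ absU u d →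
               ∃ λ j → j < u × SameEdge (diffEdge j d) (inj₁ a , inj₁ b)
  diffEdge-cover a b {d} d<u eq
    with cdist≡d⊓[n∸d]⇒b≡[a+d]%n⊎a≡[b+d]%n u (toℕ<n a) (toℕ<n b) (<⇒≤ d<u) (trans eq (absU≡d⊓[u∸d] u d d<u))
  ... | inj₁ b≡a+d = toℕ a , toℕ<n a , inj₁ (cong inj₁ (toℕ-mod-inverse a) , cong inj₁ (toℕ≡%⇒mod≡ b≡a+d))
  ... | inj₂ a≡b+d = toℕ b , toℕ<n b , inj₂ (cong inj₁ (toℕ-mod-inverse b) , cong inj₁ (toℕ≡%⇒mod≡ a≡b+d))

  [[a+[u∸e]]%u+e]mod≡a : ∀ (a : Fin u) e → e ≤ u → ((toℕ a + (u ∸ e)) % u + e) mod u ≡ a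
  [[a+[u∸e]]%u+e]mod≡a a e e≤u = toℕ-injective (begin
    toℕ (((toℕ a + (u ∸ e)) % u + e) mod u)  ≡⟨ toℕ-mod _ ⟩
    ((toℕ a + (u ∸ e)) % u + e) % u           ≡⟨ [m%n+k]%n≡[m+k]%n (toℕ a + (u ∸ e)) e u ⟩
    (toℕ a + (u ∸ e) + e) % u                 ≡⟨ cong (_% u) (+-assoc (toℕ a) (u ∸ e) e) ⟩
    (toℕ a + (u ∸ e + e)) % u                 ≡⟨ cong (λ x → (toℕ a + x) % u) (m∸n+n≡m e≤u) ⟩
    (toℕ a + u) % u                           ≡⟨ [m+n]%n≡m%n (toℕ a) u ⟩
    toℕ a % u                                 ≡⟨ m<n⇒m%n≡m (toℕ<n a) ⟩
    toℕ a                                     ∎)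

  adjacent⇒edge : ∀ x y → G x y → ∃₂ λ j c → j < u × SameEdge (edge j c) (x , y)
  adjacent⇒edge (inj₁ a) (inj₁ b) (_ , here eq) with diffEdge-cover a b 2<u eq
  ... | j , j<u , same = j , zero , j<u , same
  adjacent⇒edge (inj₁ a) (inj₁ b) (_ , there (here eq)) with diffEdge-cover a b 4<u eq
  ... | j , j<u , same = j , suc zero , j<u , same
  adjacent⇒edge (inj₁ a) (inj₂ k) _ =
    (toℕ a + (u ∸ ∞-offset k)) % u , suc (suc k) , m%n<n _ u ,
    inj₂ (refl , cong inj₁ ([[a+[u∸e]]%u+e]mod≡a a (∞-offset k) (∞-offset≤u k)))
  adjacent⇒edge (inj₂ k) (inj₁ a) _ =
    (toℕ a + (u ∸ ∞-offset k)) % u , suc (suc k) , m%n<n _ u ,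
    inj₁ (refl , cong inj₁ ([[a+[u∸e]]%u+e]mod≡a a (∞-offset k) (∞-offset≤u k)))

  diffEdge-same : ∀ {j j′ d d′} → j < u → j′ < u →
                  SameEdge (diffEdge j d) (diffEdge j′ d′) →
                  (j ≡ j′ × d % u ≡ d′ % u) ⊎ (d + d′) % u ≡ 0
  diffEdge-same {j} {j′} {d} {d′} j<u j′<u (inj₁ (p , q)) = inj₁ (j≡j′ , d≡d′)
    where
    j≡j′ : j ≡ j′
    j≡j′ = %-injective j<u j′<u (mod-≡⇒%-≡ (inj₁-injective p))
    d≡d′ : d % u ≡ d′ % u
    d≡d′ = [m+k]%n≡[m+j]%n⇒k%n≡j%n j d d′ u
             (trans (mod-≡⇒%-≡ (inj₁-injective q)) (cong (λ x → (x + d′) % u) (sym j≡j′)))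
  diffEdge-same {j} {j′} {d} {d′} _ _ (inj₂ (p , q)) = inj₂ ([m+k]%n≡m%n⇒k%n≡0 j (d + d′) u (begin
    (j + (d + d′)) % u      ≡⟨ cong (_% u) (+-assoc j d d′) ⟨
    (j + d + d′) % u        ≡⟨ [m%n+k]%n≡[m+k]%n (j + d) d′ u ⟨
    ((j + d) % u + d′) % u  ≡⟨ cong (λ x → (x + d′) % u) (mod-≡⇒%-≡ (inj₁-injective q)) ⟩
    (j′ % u + d′) % u       ≡⟨ [m%n+k]%n≡[m+k]%n j′ d′ u ⟩
    (j′ + d′) % u           ≡⟨ mod-≡⇒%-≡ (inj₁-injective p) ⟨
    j % u                   ∎))

  edge-injective : ∀ {j j′} c c′ → j < u → j′ < u → SameEdge (edge j c) (edge j′ c′) → j ≡ j′ × c ≡ c′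
  edge-injective zero zero j<u j′<u same with diffEdge-same j<u j′<u same
  ... | inj₁ (j≡j′ , _) = j≡j′ , refl
  ... | inj₂ 4%u≡0      = contradiction 4%u≡0 (0<d<u⇒d%u≢0 z<s 4<u)
  edge-injective zero (suc zero) j<u j′<u same with diffEdge-same j<u j′<u same
  ... | inj₁ (_ , 2%u≡4%u) = contradiction (%-injective 2<u 4<u 2%u≡4%u) λ ()
  ... | inj₂ 6%u≡0         = contradiction 6%u≡0 (0<d<u⇒d%u≢0 z<s 6<u)
  edge-injective (suc zero) zero j<u j′<u same with diffEdge-same j<u j′<u same
  ... | inj₁ (_ , 4%u≡2%u) = contradiction (%-injective 4<u 2<u 4%u≡2%u) λ ()
  ... | inj₂ 6%u≡0         = contradiction 6%u≡0 (0<d<u⇒d%u≢0 z<s 6<u)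
  edge-injective (suc zero) (suc zero) j<u j′<u same with diffEdge-same j<u j′<u same
  ... | inj₁ (j≡j′ , _) = j≡j′ , refl
  ... | inj₂ 8%u≡0      = contradiction 8%u≡0 8%u≢0
  edge-injective {j} {j′} (suc (suc k)) (suc (suc .k)) j<u j′<u (inj₁ (refl , q)) =
    %-injective j<u j′<u ([m+k]%n≡[m+j]%n⇒k%n≡j%n e j j′ u (begin
      (e + j) % u   ≡⟨ cong (_% u) (+-comm e j) ⟩
      (j + e) % u   ≡⟨ mod-≡⇒%-≡ (inj₁-injective q) ⟩
      (j′ + e) % u  ≡⟨ cong (_% u) (+-comm j′ e) ⟩
      (e + j′) % u  ∎)) , refl
    where
    e : ℕ
    e = ∞-offset k
  edge-injective (suc (suc _)) (suc (suc _)) _ _ (inj₂ (() , _))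
  edge-injective zero          (suc (suc _)) _ _ (inj₁ (() , _))
  edge-injective zero          (suc (suc _)) _ _ (inj₂ (_ , ()))
  edge-injective (suc zero)    (suc (suc _)) _ _ (inj₁ (() , _))
  edge-injective (suc zero)    (suc (suc _)) _ _ (inj₂ (_ , ()))
  edge-injective (suc (suc _)) zero          _ _ (inj₁ (() , _))
  edge-injective (suc (suc _)) zero          _ _ (inj₂ (() , _))
  edge-injective (suc (suc _)) (suc zero)    _ _ (inj₁ (() , _))
  edge-injective (suc (suc _)) (suc zero)    _ _ (inj₂ (() , _))

  shift-separated : ∀ s {p q} → Separated p q → vertex (shift s p) ≢ vertex (shift s q)
  shift-separated s {pt a} {pt b} (a≢b , near) eq =
    a≢b (∣m-k∣<n⇒m%n≡k%n⇒m≡k a b u (<-≤-trans near 7≤u)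
          ([m+k]%n≡[m+j]%n⇒k%n≡j%n s a b u (mod-≡⇒%-≡ (inj₁-injective eq))))
  shift-separated s {∞ i} {∞ j} i≢j eq = i≢j (inj₂-injective eq)

  placedSun : (p : Place) → offset p < size (block p) → Sun V
  placedSun p t<b = record { vert = vertex ∘ shift (start p) ∘ point (block p) (offset p) ; inj = injective }
    where
    injective : ∀ {k k′} → vertex (shift (start p) (point (block p) (offset p) k)) ≡ vertex (shift (start p) (point (block p) (offset p) k′)) → k ≡ k′
    injective {k} {k′} eq with k ≟ᶠ k′
    ... | yes k≡k′ = k≡k′
    ... | no k≢k′  = contradiction eq (shift-separated (start p) (sun-separated (block p) t<b k k′ k≢k′))

  module _ (bs : List Block) (total≡u : total bs ≡ u) where

    sunAt : ℕ → Sun V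
    sunAt n = placedSun (locate bs n) (locate-offset< bs n)

    globalSlot : ℕ → Fin 6 → ℕ × Fin 6
    globalSlot n = slotAt (locate bs n)

    sunAt-edge : ∀ n k → SameEdge (sunEdge (sunAt n) k) (uncurry edge (globalSlot n k))
    sunAt-edge n k =
      subst (SameEdge (sunEdge (sunAt n) k)) (cong (Prod.map vertex vertex) (shift-baseEdge (start p) x c))
        (SameEdge-map (vertex ∘ shift (start p)) (sunEdge-base (block p) (locate-offset< bs n) k))
      where
      p : Place
      p = locate bs n
      x : ℕ
      x = proj₁ (slot (block p) (offset p) k)
      c : Fin 6
      c = proj₂ (slot (block p) (offset p) k)

    <u⇒<total : ∀ {n} → n < u → n < total bs
    <u⇒<total {n} = subst (n <_) (sym total≡u)

    inBlock<u : ∀ {n x} → n < u → x < size (block (locate bs n)) → start (locate bs n) + x < u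
    inBlock<u {n} n<u x<b = <-≤-trans (+-monoʳ-< (start p) x<b)
      (subst (start p + size (block p) ≤_) total≡u (locate-end≤total bs (<u⇒<total n<u)))
      where
      p : Place
      p = locate bs n

    globalSlot-< : ∀ {n} k → n < u → proj₁ (globalSlot n k) < u
    globalSlot-< {n} k n<u = inBlock<u n<u (slot-< (block (locate bs n)) (locate-offset< bs n) k)

    locate-globalSlot : ∀ {n} k → n < u →
                        locate bs (proj₁ (globalSlot n k)) ≡ place (block (locate bs n)) (start (locate bs n)) _
    locate-globalSlot {n} k n<u =
      locate-sameBlock bs (<u⇒<total n<u) (slot-< (block (locate bs n)) (locate-offset< bs n) k)

    globalSlot-injective : ∀ {n n′} k k′ → n < u → n′ < u → globalSlot n k ≡ globalSlot n′ k′ → n ≡ n′ × k ≡ k′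
    globalSlot-injective {n} {n′} k k′ n<u n′<u eq = n≡n′ , proj₂ offsets≡
      where
      p p′ : Place
      p  = locate bs n
      p′ = locate bs n′
      samePlace : place (block p) (start p) _ ≡ place (block p′) (start p′) _
      samePlace = trans (sym (locate-globalSlot k n<u))
                    (trans (cong (locate bs ∘ proj₁) eq) (locate-globalSlot k′ n′<u))
      offsets≡ : offset p ≡ offset p′ × k ≡ k′
      offsets≡ = slotAt-injective k k′ (cong block samePlace) (cong start samePlace)
                   (locate-offset< bs n) (locate-offset< bs n′) eq
      n≡n′ : n ≡ n′
      n≡n′ = begin
        n                      ≡⟨ locate-start+offset bs n ⟨
        start p + offset p     ≡⟨ cong₂ _+_ (cong start samePlace) (proj₁ offsets≡) ⟩
        start p′ + offset p′   ≡⟨ locate-start+offset bs n′ ⟩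
        n′                     ∎

    globalSlot-surjective : ∀ {j} c → j < u → ∃₂ λ n k → n < u × globalSlot n k ≡ (j , c)
    globalSlot-surjective {j} c j<u =
      let t , k , t<b , slot≡ = slot-surjective (block p) (locate-offset< bs j) c
      in start p + t , k , inBlock<u j<u t<b , (begin
        slotAt (locate bs (start p + t)) k       ≡⟨ cong (λ q → slotAt q k) (locate-sameBlock bs (<u⇒<total j<u) t<b) ⟩
        slotAt (place (block p) (start p) t) k   ≡⟨ cong (Prod.map₁ (start p +_)) slot≡ ⟩
        (start p + offset p , c)                 ≡⟨ cong (_, c) (locate-start+offset bs j) ⟩
        (j , c)                                  ∎)
      where
      p : Place
      p = locate bs j

    sunAt-covers : ∀ x y → G x y → ∃₂ λ n k → n < u × SameEdge (sunEdge (sunAt n) k) (x , y)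
    sunAt-covers x y g =
      let j , c , j<u , edge≡xy = adjacent⇒edge x y g
          n , k , n<u , slot≡   = globalSlot-surjective c j<u
      in n , k , n<u , SameEdge-trans (subst (SameEdge (sunEdge (sunAt n) k) ∘ uncurry edge) slot≡ (sunAt-edge n k)) edge≡xy

    sunAt-disjoint : ∀ {n n′} k k′ → n < u → n′ < u →
                     SameEdge (sunEdge (sunAt n) k) (sunEdge (sunAt n′) k′) → n ≡ n′ × k ≡ k′
    sunAt-disjoint {n} {n′} k k′ n<u n′<u same =
      let j≡j′ , c≡c′ = edge-injective (proj₂ (globalSlot n k)) (proj₂ (globalSlot n′ k′))
                          (globalSlot-< k n<u) (globalSlot-< k′ n′<u)
                          (SameEdge-trans (SameEdge-sym (sunAt-edge n k)) (SameEdge-trans same (sunAt-edge n′ k′)))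
      in globalSlot-injective k k′ n<u n′<u (×-≡,≡→≡ (j≡j′ , c≡c′))

    suns : List (Sun V)
    suns = applyUpTo sunAt u

    length-suns : length suns ≡ u
    length-suns = length-applyUpTo sunAt u

    lookup-suns : ∀ i → lookup suns i ≡ sunAt (toℕ i)
    lookup-suns = lookup-applyUpTo sunAt u

    decomposition : IsSunDecomposition G suns
    decomposition = record { sound = sound ; covers = covers ; disjoint = disjoint }
      where
      index<u : (i : Fin (length suns)) → toℕ i < u
      index<u i = subst (toℕ i <_) length-suns (toℕ<n i)

      sound : ∀ i k → G (proj₁ (sunEdge (lookup suns i) k)) (proj₂ (sunEdge (lookup suns i) k))
      sound i k rewrite lookup-suns i =
        G-resp-SameEdge (uncurry edge-adjacent (globalSlot (toℕ i) k)) (SameEdge-sym (sunAt-edge (toℕ i) k))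

      covers : ∀ x y → G x y → ∃₂ λ i k → SameEdge (sunEdge (lookup suns i) k) (x , y)
      covers x y g =
        let n , k , n<u , same = sunAt-covers x y g
            i = fromℕ< (subst (n <_) (sym length-suns) n<u)
        in i , k , subst (λ s → SameEdge (sunEdge s k) (x , y))
                     (sym (trans (lookup-suns i) (cong sunAt (toℕ-fromℕ< _)))) same

      disjoint : ∀ i i′ k k′ → SameEdge (sunEdge (lookup suns i) k) (sunEdge (lookup suns i′) k′) → i ≡ i′ × k ≡ k′
      disjoint i i′ k k′ same rewrite lookup-suns i | lookup-suns i′ =
        Prod.map₁ toℕ-injective (sunAt-disjoint k k′ (index<u i) (index<u i′) same)

lemma2p3 : (u : ℕ) → u ≥ 7 → u ≢ 8 →
    u % 12 ∈ (0 ∷ 1 ∷ 3 ∷ 4 ∷ 5 ∷ 7 ∷ 8 ∷ 9 ∷ 11 ∷ []) →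
    HasSunDecomposition (Adj u 4 (2 ∷ 4 ∷ []))
lemma2p3 u u≥7 u≢8 _ =
  let bs , total≡u = tiling u u≥7 u≢8
  in _ , Construction.decomposition u {{>-nonZero (≤-trans (s≤s z≤n) u≥7)}} u≥7 u≢8 bs total≡u
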